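{- For $F\in\mathbb{N}$, the number $\mathrm{nF}(F)$ of reflective numerical semigroups $S$ with Frobenius number $F(S)=F$ is \[ \mathrm{nF}(F)=1+\#\left\{a\in\{1,\dots,F\} : a\nmid F,\ \lfloor F/a\rfloor\equiv 0\pmod 2\right\}. \]
   Context: A numerical semigroup is a submonoid $S$ of $(\mathbb{N}_0,+)$ with finite complement; $g(S)=\#(\mathbb{N}_0\setminus S)$ and (for $g(S)\ge1$) $F(S)$ is the largest element of $\mathbb{N}_0\setminus S$. $S$ (with $g=g(S)\ge1$) is reflective if for every integer $z$ with $0\le z\le g-1$ exactly one of $z$ and $z+g$ lies in $S$. -}

module Defs where

open import Data.Nat using (ℕ; zero; suc; _+_; _≤_; _<_; _<?_; _≟_; _/_; _%_)
open import Data.Nat.Divisibility using (_∣_; _∣?_)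
open import Data.Bool using (Bool; true; false)
open import Data.Vec using (Vec; lookup)
open import Data.Fin using (fromℕ<)
open import Data.List using (List; filter; map; upTo; length)
open import Data.List.Membership.Propositional using (_∈_)
open import Data.List.Relation.Unary.Unique.Propositional using (Unique)
open import Data.Product using (Σ; ∃; _×_; _,_)
open import Data.Sum using (_⊎_)
open import Relation.Nullary using (¬_; yes; no)
open import Relation.Nullary.Decidable using (¬?; _×-dec_)
open import Relation.Binary.PropositionalEquality using (_≡_)
open import Function.Bundles using (_⇔_)

Subsetℕ : Set₁
Subsetℕ = ℕ → Set

record IsNumericalSemigroup (S : Subsetℕ) : Set where
  field
    zero∈  : S 0
    closed : ∀ x y → S x → S y → S (x + y)
    cofinite : ∃ λ b → ∀ n → b ≤ n → S n

HasGenus : Subsetℕ → ℕ → Set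
HasGenus S g = Σ (List ℕ) λ L → Unique L × (∀ x → x ∈ L ⇔ (¬ S x)) × length L ≡ g

HasFrobenius : Subsetℕ → ℕ → Set
HasFrobenius S F = (¬ S F) × (∀ n → F < n → S n)

IsReflective : Subsetℕ → Set
IsReflective S = ∀ g → HasGenus S g → 1 ≤ g →
  ∀ z → z < g → (S z × ¬ S (z + g)) ⊎ (¬ S z × S (z + g))

-- A set S ⊆ ℕ₀ with all n > F in S is determined by S ∩ {0,…,F}; we encode
-- it by its characteristic vector v of length F+1.
memb : {F : ℕ} → Vec Bool (suc F) → ℕ → Bool
memb {F} v x with x <? suc F
... | yes p = lookup v (fromℕ< p)
... | no _  = true

setOf : {F : ℕ} → Vec Bool (suc F) → Subsetℕ
setOf v x = memb v x ≡ true

IsReflectiveNSWithFrobenius : (F : ℕ) → Vec Bool (suc F) → Set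
IsReflectiveNSWithFrobenius F v =
  IsNumericalSemigroup (setOf v) × HasFrobenius (setOf v) F × IsReflective (setOf v)

-- #{ a ∈ {1,…,F} : a ∤ F, ⌊F/a⌋ ≡ 0 mod 2 }   (a = suc k, k ∈ {0,…,F-1})
countA : ℕ → ℕ
countA F = length (filter (λ k → ¬? (suc k ∣? F) ×-dec ((F / suc k) % 2 ≟ 0)) (upTo F))

{-# OPTIONS --safe #-}
-- In a reflective numerical semigroup S of genus g, reflectivity gives x + g ∈ S ⇔ x ∉ S for x < g,
-- so [0, 2g) already contains g gaps and [2g, ∞) ⊆ S.  Closure under addition then forces
-- S ∩ [0, g) = aℕ ∩ [0, g), with a the least positive element of S (or a = g), hence
-- S = aℕ ∩ [0, g) ∪ { x ∈ [g, 2g) : a ∤ x − g } ∪ [2g, ∞).  Its Frobenius number is g + q a, with q a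
-- the largest multiple of a below g; writing g = q a + r (1 ≤ r ≤ a, and r = a only when q = 0) gives
-- F = 2 q a + r, and conversely every such pair (a, g) gives a reflective semigroup.  So for fixed F
-- the semigroups correspond to a = F (with g = F) and to the a < F with a ∤ F and ⌊F / a⌋ = 2 q even.
module Submission where

open import Defs
open import Data.Nat
  using (ℕ; zero; suc; pred; _+_; _*_; _∸_; _≤_; _<_; _≤?_; _<?_; _≟_; _/_; _%_; z≤n; s≤s; NonZero; >-nonZero)
open import Data.Nat.Properties
open import Data.Nat.DivMod
  using (m≡m%n+[m/n]*n; m%n<n; [m+kn]%n≡m%n; m<n⇒m%n≡m; +-distrib-/; m<n⇒m/n≡0; m*n/n≡m; m*n%n≡0; n/n≡1)
open import Data.Nat.Divisibility
  using ( _∣_; _∣?_; divides; _∣0; ∣-refl; n∣m*n; ∣m∣n⇒∣m+n; ∣m+n∣m⇒∣n; ∣m∸n∣n⇒∣m; >⇒∤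
        ; n∣m⇒m%n≡0; m%n≡0⇒n∣m)
open import Data.Nat.Induction using (<-rec)
open import Algebra.Properties.CommutativeSemigroup +-commutativeSemigroup using (xy∙z≈xz∙y)
open import Data.Nat.Solver using (module +-*-Solver)
open import Data.Bool using (Bool; true; false; not) renaming (_≟_ to _≟ᵇ_)
open import Data.Bool.Properties using (not-involutive; not-injective; ¬-not)
open import Data.Vec using (Vec; lookup; tabulate)
open import Data.Vec.Properties using (lookup∘tabulate; tabulate∘lookup; tabulate-cong)
open import Data.Fin using (toℕ; fromℕ<)
open import Data.Fin.Properties using (toℕ-fromℕ<; fromℕ<-toℕ; toℕ<n)
open import Data.List using (List; []; _∷_; filter; map; upTo; downFrom; length)
open import Data.List.Properties using (length-map)
open import Data.List.Membership.Propositional using (_∈_)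
open import Data.List.Membership.Propositional.Properties
  using (∈-filter⁺; ∈-filter⁻; ∈-upTo⁺; ∈-upTo⁻; ∈-downFrom⁺; ∈-map⁺; ∈-map⁻)
open import Data.List.Membership.Propositional.Properties.WithK using (unique∧set⇒bag)
open import Data.List.Relation.Unary.Any using (here; there)
open import Data.List.Relation.Unary.All as All using ()
import Data.List.Relation.Unary.All.Properties as All
open import Data.List.Relation.Unary.Unique.Propositional using (Unique; []; _∷_)
open import Data.List.Relation.Unary.Unique.Propositional.Properties using (upTo⁺; downFrom⁺; filter⁺)
open import Data.List.Relation.Binary.BagAndSetEquality using (∼bag⇒↭)
open import Data.List.Relation.Binary.Permutation.Propositional.Properties using (↭-length)
open import Data.Product using (Σ; ∃₂; ∃-syntax; _×_; _,_; proj₁; proj₂)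
open import Data.Sum using (_⊎_; inj₁; inj₂; [_,_]′)
open import Function using (_∘_; id)
open import Function.Bundles using (_⇔_; mk⇔; Equivalence)
open import Relation.Nullary using (¬_; Dec; yes; no; does; contradiction)
open import Relation.Nullary.Decidable using (¬?; _×-dec_; _⊎-dec_; dec-true; dec-false)
open import Relation.Unary using (Decidable)
open import Relation.Binary.PropositionalEquality
  using (_≡_; _≢_; refl; sym; trans; cong; cong₂; subst; module ≡-Reasoning)
open import Relation.Binary.Definitions using (tri<; tri≈; tri>)

module _ {A : Set} where

  length-unique : {xs ys : List A} → Unique xs → Unique ys →
    (∀ {x} → x ∈ xs ⇔ x ∈ ys) → length xs ≡ length ys
  length-unique uxs uys xs⇔ys = ↭-length (∼bag⇒↭ (unique∧set⇒bag uxs uys xs⇔ys))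

  unique-map⁺ : {B : Set} {f : A → B} {xs : List A} →
    (∀ {x y} → x ∈ xs → y ∈ xs → f x ≡ f y → x ≡ y) → Unique xs → Unique (map f xs)
  unique-map⁺ inj [] = []
  unique-map⁺ inj (x∉xs ∷ uxs) =
    All.map⁺ (All.tabulate λ y∈xs fx≡fy → All.lookup x∉xs y∈xs (inj (here refl) (there y∈xs) fx≡fy))
    ∷ unique-map⁺ (λ x∈xs y∈xs → inj (there x∈xs) (there y∈xs)) uxs

dec-true⁻¹ : {P : Set} (p? : Dec P) → does p? ≡ true → P
dec-true⁻¹ (yes p) _ = p

dec-false⁻¹ : {P : Set} (p? : Dec P) → does p? ≡ false → ¬ P
dec-false⁻¹ (no ¬p) _ = ¬p

least-below : {P : ℕ → Set} → Decidable P → ∀ n →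
  (∃[ m ] m < n × P m × (∀ {y} → y < m → ¬ P y)) ⊎ (∀ {y} → y < n → ¬ P y)
least-below P? zero = inj₂ λ ()
least-below P? (suc n) with least-below P? n
... | inj₁ (m , m<n , pm , below-m) = inj₁ (m , m<n⇒m<1+n m<n , pm , below-m)
... | inj₂ below-n with P? n
...   | yes pn = inj₁ (n , n<1+n n , pn , below-n)
...   | no ¬pn = inj₂ λ y<1+n → [ below-n , (λ { refl → ¬pn }) ]′ (m<1+n⇒m<n∨m≡n y<1+n)

least-witness : {P : ℕ → Set} → Decidable P → ∀ {n} → P n → ∃[ m ] P m × (∀ {y} → y < m → ¬ P y)
least-witness P? {n} pn with least-below P? n
... | inj₁ (m , _ , pm , below-m) = m , pm , below-m
... | inj₂ below-n                = n , pn , below-n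

multiple-above : ∀ {a u} q → a ∣ u → q * a < u → q * a + a ≤ u
multiple-above {a} q (divides k refl) qa<ka = begin
  q * a + a  ≡⟨ +-comm (q * a) a ⟩
  suc q * a  ≤⟨ *-monoˡ-≤ a (*-cancelʳ-< a q k qa<ka) ⟩
  k * a      ∎
  where open ≤-Reasoning

∣∧<⇒≡0 : ∀ {a x} → a ∣ x → x < a → x ≡ 0
∣∧<⇒≡0 {x = zero}  _   _   = refl
∣∧<⇒≡0 {x = suc x} a∣x x<a = contradiction a∣x (>⇒∤ x<a)

m<n+n⇒m∸n<n : ∀ {m n} → n ≤ m → m < n + n → m ∸ n < n
m<n+n⇒m∸n<n {m} {n} n≤m m<2n = +-cancelʳ-< n (m ∸ n) n (subst (_< n + n) (sym (m∸n+n≡m n≤m)) m<2n)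

r+kd%d≡r : ∀ {r d} k .{{_ : NonZero d}} → r < d → (r + k * d) % d ≡ r
r+kd%d≡r {r} {d} k r<d = trans ([m+kn]%n≡m%n r k d) (m<n⇒m%n≡m r<d)

r+kd/d≡k : ∀ {r d} k .{{_ : NonZero d}} → r < d → (r + k * d) / d ≡ k
r+kd/d≡k {r} {d} k r<d = begin
  (r + k * d) / d    ≡⟨ +-distrib-/ r (k * d) (subst (_< d) (sym r%d+kd%d≡r) r<d) ⟩
  r / d + k * d / d  ≡⟨ cong₂ _+_ (m<n⇒m/n≡0 r<d) (m*n/n≡m k d) ⟩
  k                  ∎
  where
  open ≡-Reasoning
  r%d+kd%d≡r : r % d + k * d % d ≡ r
  r%d+kd%d≡r = trans (cong₂ _+_ (m<n⇒m%n≡m r<d) (m*n%n≡0 k d)) (+-identityʳ r)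

-- Gaps of a cofinite subset of ℕ given by a Boolean predicate

gaps : (ℕ → Bool) → ℕ → List ℕ
gaps s n = filter (λ x → ¬? (s x ≟ᵇ true)) (downFrom n)

#gaps : (ℕ → Bool) → ℕ → ℕ
#gaps s n = length (gaps s n)

#gaps-suc-gap : ∀ s n → s n ≡ false → #gaps s (suc n) ≡ suc (#gaps s n)
#gaps-suc-gap s n sn≡false rewrite sn≡false = refl

#gaps-+ : ∀ s k m → #gaps s (k + m) ≡ #gaps (λ z → s (z + m)) k + #gaps s m
#gaps-+ s zero    m = refl
#gaps-+ s (suc k) m with s (k + m)
... | true  = #gaps-+ s k m
... | false = cong suc (#gaps-+ s k m)

#gaps-mono : ∀ s {m n} → m ≤ n → #gaps s m ≤ #gaps s n
#gaps-mono s {m} {n} m≤n = begin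
  #gaps s m                                       ≤⟨ m≤n+m _ _ ⟩
  #gaps (λ z → s (z + m)) (n ∸ m) + #gaps s m     ≡⟨ #gaps-+ s (n ∸ m) m ⟨
  #gaps s (n ∸ m + m)                             ≡⟨ cong (#gaps s) (m∸n+n≡m m≤n) ⟩
  #gaps s n                                       ∎
  where open ≤-Reasoning

#gaps-complementary : ∀ s t n → (∀ z → z < n → s z ≡ not (t z)) → #gaps s n + #gaps t n ≡ n
#gaps-complementary s t zero    _ = refl
#gaps-complementary s t (suc n) s≡not-t
  with s n | t n | s≡not-t n (n<1+n n)
     | #gaps-complementary s t n (λ z z<n → s≡not-t z (m<n⇒m<1+n z<n))
... | true  | false | _ | ih = trans (+-suc _ _) (cong suc ih)
... | false | true  | _ | ih = cong suc ih

#gaps-double : ∀ s g → (∀ z → z < g → s (z + g) ≡ not (s z)) → #gaps s (g + g) ≡ g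
#gaps-double s g reflection =
  trans (#gaps-+ s g g) (#gaps-complementary (λ z → s (z + g)) s g reflection)

hasGenus-#gaps : ∀ s n → (∀ x → n ≤ x → s x ≡ true) → HasGenus (λ x → s x ≡ true) (#gaps s n)
hasGenus-#gaps s n s-above =
  gaps s n , filter⁺ gap? (downFrom⁺ n) ,
  (λ x → mk⇔ (proj₂ ∘ ∈-filter⁻ gap? {xs = downFrom n}) (gap x)) , refl
  where
  gap? = λ x → ¬? (s x ≟ᵇ true)
  gap : ∀ x → ¬ s x ≡ true → x ∈ gaps s n
  gap x ¬sx = ∈-filter⁺ gap? (∈-downFrom⁺ (≰⇒> (¬sx ∘ s-above x))) ¬sx

genus-unique : ∀ {S g g′} → HasGenus S g → HasGenus S g′ → g ≡ g′
genus-unique (L , uL , L⇔ , refl) (L′ , uL′ , L′⇔ , refl) =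
  length-unique uL uL′ λ {x} → mk⇔ (Equivalence.from (L′⇔ x) ∘ Equivalence.to (L⇔ x))
                                   (Equivalence.from (L⇔ x) ∘ Equivalence.to (L′⇔ x))

reflective-at : ∀ s g → (∀ z → z < g → s (z + g) ≡ not (s z)) → (∀ x → g + g ≤ x → s x ≡ true) →
  IsReflective (λ x → s x ≡ true)
reflective-at s g reflection s-above g′ genus-g′ _ z z<g′
  with trans (genus-unique genus-g′ (hasGenus-#gaps s (g + g) s-above)) (#gaps-double s g reflection)
... | refl with s z | reflection z z<g′
...   | true  | s[z+g]≡false =
  inj₁ (refl , λ s[z+g]≡true → contradiction (trans (sym s[z+g]≡true) s[z+g]≡false) λ ())
...   | false | s[z+g]≡true  = inj₂ ((λ ()) , s[z+g]≡true)

reflection-at-genus : ∀ {b c} → (b ≡ true × ¬ c ≡ true) ⊎ (¬ b ≡ true × c ≡ true) → c ≡ not b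
reflection-at-genus (inj₁ (b≡true , c≢true)) = ¬-not λ c≡b → c≢true (trans c≡b b≡true)
reflection-at-genus (inj₂ (b≢true , c≡true)) = ¬-not λ c≡b → b≢true (trans (sym c≡b) c≡true)

vecOf : (F : ℕ) → (ℕ → Bool) → Vec Bool (suc F)
vecOf F f = tabulate (f ∘ toℕ)

memb-vecOf : ∀ F f → (∀ x → F < x → f x ≡ true) → ∀ x → memb (vecOf F f) x ≡ f x
memb-vecOf F f f-above x with x <? suc F
... | yes x<1+F = trans (lookup∘tabulate (f ∘ toℕ) (fromℕ< x<1+F)) (cong f (toℕ-fromℕ< x<1+F))
... | no  x≮1+F = sym (f-above x (≰⇒> (x≮1+F ∘ s≤s)))

memb-toℕ : ∀ {F} (v : Vec Bool (suc F)) i → memb v (toℕ i) ≡ lookup v i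
memb-toℕ {F} v i with toℕ i <? suc F
... | yes i<1+F = cong (lookup v) (fromℕ<-toℕ i i<1+F)
... | no  i≮1+F = contradiction (toℕ<n i) i≮1+F

≡vecOf : ∀ {F} (v : Vec Bool (suc F)) f → (∀ x → x ≤ F → memb v x ≡ f x) → v ≡ vecOf F f
≡vecOf v f v≗f = trans (sym (tabulate∘lookup v))
  (tabulate-cong λ i → trans (sym (memb-toℕ v i)) (v≗f (toℕ i) (≤-pred (toℕ<n i))))

-- The semigroups S⟨ a , g ⟩

S⟨_,_⟩ : ℕ → ℕ → ℕ → Bool
S⟨ a , g ⟩ x with x <? g | x <? g + g
... | yes _ | _     = does (a ∣? x)
... | no  _ | yes _ = not (does (a ∣? (x ∸ g)))
... | no  _ | no  _ = true

module S-Properties (a g : ℕ) where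

  S-low : ∀ {x} → x < g → S⟨ a , g ⟩ x ≡ does (a ∣? x)
  S-low {x} x<g with x <? g | x <? g + g
  ... | yes _   | _ = refl
  ... | no  x≮g | _ = contradiction x<g x≮g

  S-mid : ∀ {x} → g ≤ x → x < g + g → S⟨ a , g ⟩ x ≡ not (does (a ∣? (x ∸ g)))
  S-mid {x} g≤x x<2g with x <? g | x <? g + g
  ... | yes x<g | _        = contradiction g≤x (<⇒≱ x<g)
  ... | no  _   | yes _    = refl
  ... | no  _   | no x≮2g  = contradiction x<2g x≮2g

  S-high : ∀ {x} → g + g ≤ x → S⟨ a , g ⟩ x ≡ true
  S-high {x} 2g≤x with x <? g | x <? g + g
  ... | yes x<g  | _        = contradiction (≤-trans (m≤m+n g g) 2g≤x) (<⇒≱ x<g)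
  ... | no  _    | yes x<2g = contradiction 2g≤x (<⇒≱ x<2g)
  ... | no  _    | no  _    = refl

  S-low-∣ : ∀ {x} → x < g → S⟨ a , g ⟩ x ≡ true → a ∣ x
  S-low-∣ {x} x<g x∈S = dec-true⁻¹ (a ∣? x) (trans (sym (S-low x<g)) x∈S)

  S-mid-∤ : ∀ {x} → g ≤ x → x < g + g → S⟨ a , g ⟩ x ≡ true → ¬ a ∣ (x ∸ g)
  S-mid-∤ {x} g≤x x<2g x∈S =
    dec-false⁻¹ (a ∣? (x ∸ g)) (not-injective (trans (sym (S-mid g≤x x<2g)) x∈S))

  S-reflect : ∀ {z} → z < g → S⟨ a , g ⟩ (z + g) ≡ not (S⟨ a , g ⟩ z)
  S-reflect {z} z<g = begin
    S⟨ a , g ⟩ (z + g)             ≡⟨ S-mid (m≤n+m g z) (+-monoˡ-< g z<g) ⟩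
    not (does (a ∣? (z + g ∸ g)))  ≡⟨ cong (λ w → not (does (a ∣? w))) (m+n∸n≡m z g) ⟩
    not (does (a ∣? z))            ≡⟨ cong not (S-low z<g) ⟨
    not (S⟨ a , g ⟩ z)             ∎
    where open ≡-Reasoning

-- With r = g ∸ q a: g = q a + r, 1 ≤ r ≤ a with r = a only if q = 0, and F = 2 q a + r.
record Admissible (F a g : ℕ) : Set where
  field
    q        : ℕ
    F≡g+qa   : F ≡ g + q * a
    qa<g     : q * a < g
    g≤qa+a   : g ≤ q * a + a
    a∣g⇒q≡0  : a ∣ g → q ≡ 0

module Admissibility {F a g : ℕ} (adm : Admissible F a g) where
  open Admissible adm

  a<g⊎F≡g≤a : a < g ⊎ (F ≡ g × g ≤ a)
  a<g⊎F≡g≤a with q | F≡g+qa | qa<g | g≤qa+a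
  ... | zero   | F≡g+0 | _    | g≤a = inj₂ (trans F≡g+0 (+-identityʳ g) , g≤a)
  ... | suc q′ | _     | qa<g′ | _  = inj₁ (≤-<-trans (m≤m+n a (q′ * a)) qa<g′)

  a≤F⇒a≤g : a ≤ F → a ≤ g
  a≤F⇒a≤g a≤F = [ <⇒≤ , (λ (F≡g , _) → subst (a ≤_) F≡g a≤F) ]′ a<g⊎F≡g≤a

  a<F⇒a<g : a < F → a < g
  a<F⇒a<g a<F =
    [ id , (λ (F≡g , g≤a) → contradiction (subst (_≤ a) (sym F≡g) g≤a) (<⇒≱ a<F)) ]′ a<g⊎F≡g≤a

  r : ℕ
  r = g ∸ q * a

  g≡qa+r : g ≡ q * a + r
  g≡qa+r = sym (m+[n∸m]≡n (<⇒≤ qa<g))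

  1≤r : 1 ≤ r
  1≤r = m<n⇒0<n∸m qa<g

  a∣g⇒g≤a : a ∣ g → g ≤ a
  a∣g⇒g≤a a∣g = subst (λ k → g ≤ k * a + a) (a∣g⇒q≡0 a∣g) g≤qa+a

  a<g⇒r<a : a < g → r < a
  a<g⇒r<a a<g = ≤∧≢⇒< (m≤n+o⇒m∸n≤o g (q * a) g≤qa+a) λ r≡a → <⇒≱ a<g (a∣g⇒g≤a (a∣g r≡a))
    where
    a∣g : r ≡ a → a ∣ g
    a∣g r≡a = subst (a ∣_) (sym (trans g≡qa+r (cong (q * a +_) r≡a))) (∣m∣n⇒∣m+n (n∣m*n q) ∣-refl)

module Soundness {F a g : ℕ} (adm : Admissible F a g) where
  open Admissible adm
  open Admissibility adm using (a∣g⇒g≤a)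
  open S-Properties a g

  S : ℕ → Bool
  S = S⟨ a , g ⟩

  0<g : 0 < g
  0<g = ≤-<-trans z≤n qa<g

  g≤F : g ≤ F
  g≤F = subst (g ≤_) (sym F≡g+qa) (m≤m+n g (q * a))

  F<g+g : F < g + g
  F<g+g = subst (_< g + g) (sym F≡g+qa) (+-monoʳ-< g qa<g)

  S-zero : S 0 ≡ true
  S-zero = trans (S-low 0<g) (dec-true (a ∣? 0) (a ∣0))

  S-F : S F ≡ false
  S-F = trans (S-mid g≤F F<g+g) (cong not (dec-true (a ∣? (F ∸ g)) (subst (a ∣_) (sym F∸g≡qa) (n∣m*n q))))
    where
    F∸g≡qa : F ∸ g ≡ q * a
    F∸g≡qa = trans (cong (_∸ g) F≡g+qa) (m+n∸m≡n g (q * a))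

  -- x − g lies strictly between the multiples q a and q a + a of a.
  S-above-F : ∀ x → F < x → S x ≡ true
  S-above-F x F<x with g + g ≤? x
  ... | yes 2g≤x = S-high 2g≤x
  ... | no  2g≰x = trans (S-mid g≤x x<2g) (cong not (dec-false (a ∣? (x ∸ g)) a∤x∸g))
    where
    x<2g = ≰⇒> 2g≰x
    g≤x  = ≤-trans g≤F (<⇒≤ F<x)
    qa<x∸g : q * a < x ∸ g
    qa<x∸g = m+n≤o⇒m≤o∸n (suc (q * a)) (subst (_< x) (trans F≡g+qa (+-comm g (q * a))) F<x)
    a∤x∸g : ¬ a ∣ (x ∸ g)
    a∤x∸g a∣x∸g = <⇒≱ (<-≤-trans (m<n+n⇒m∸n<n g≤x x<2g) g≤qa+a) (multiple-above q a∣x∸g qa<x∸g)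

  S-closed-mid : ∀ {x y} → g ≤ x → x + y < g + g → S x ≡ true → S y ≡ true → S (x + y) ≡ true
  S-closed-mid {x} {y} g≤x x+y<2g x∈S y∈S =
    trans (S-mid (≤-trans g≤x (m≤m+n x y)) x+y<2g) (cong not (dec-false (a ∣? (x + y ∸ g)) a∤))
    where
    y<g : y < g
    y<g = +-cancelˡ-< g y g (≤-<-trans (+-monoˡ-≤ y g≤x) x+y<2g)
    a∤ : ¬ a ∣ (x + y ∸ g)
    a∤ a∣ = S-mid-∤ g≤x (≤-<-trans (m≤m+n x y) x+y<2g) x∈S
      (∣m+n∣m⇒∣n (subst (a ∣_) (trans (+-∸-comm y g≤x) (+-comm (x ∸ g) y)) a∣) (S-low-∣ y<g y∈S))

  -- If x + y ≥ g for multiples x, y < g of a and a ∣ x + y − g, then a ∣ g, so q = 0, g ≤ a and x = y = 0.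
  S-closed-low : ∀ {x y} → x < g → y < g → S x ≡ true → S y ≡ true → S (x + y) ≡ true
  S-closed-low {x} {y} x<g y<g x∈S y∈S
    with g ≤? x + y | ∣m∣n⇒∣m+n (S-low-∣ x<g x∈S) (S-low-∣ y<g y∈S)
  ... | no  g≰x+y | a∣x+y = trans (S-low (≰⇒> g≰x+y)) (dec-true (a ∣? (x + y)) a∣x+y)
  ... | yes g≤x+y | a∣x+y = trans (S-mid g≤x+y (+-mono-< x<g y<g)) (cong not (dec-false (a ∣? (x + y ∸ g)) a∤))
    where
    a∤ : ¬ a ∣ (x + y ∸ g)
    a∤ a∣ = <⇒≱ 0<g (subst (g ≤_) (cong₂ _+_ (∣∧<⇒≡0 (S-low-∣ x<g x∈S) (<-≤-trans x<g g≤a))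
                                              (∣∧<⇒≡0 (S-low-∣ y<g y∈S) (<-≤-trans y<g g≤a))) g≤x+y)
      where
      g≤a : g ≤ a
      g≤a = a∣g⇒g≤a (∣m+n∣m⇒∣n (subst (a ∣_) (sym (m∸n+n≡m g≤x+y)) a∣x+y) a∣)

  S-closed : ∀ x y → S x ≡ true → S y ≡ true → S (x + y) ≡ true
  S-closed x y x∈S y∈S with g + g ≤? x + y | g ≤? x | g ≤? y
  ... | yes 2g≤x+y | _       | _       = S-high 2g≤x+y
  ... | no  2g≰x+y | yes g≤x | _       = S-closed-mid g≤x (≰⇒> 2g≰x+y) x∈S y∈S
  ... | no  2g≰x+y | no  _   | yes g≤y =
    subst (λ w → S w ≡ true) (+-comm y x)
      (S-closed-mid g≤y (subst (_< g + g) (+-comm x y) (≰⇒> 2g≰x+y)) y∈S x∈S)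
  ... | no  _      | no  g≰x | no  g≰y = S-closed-low (≰⇒> g≰x) (≰⇒> g≰y) x∈S y∈S

  isReflectiveNS : IsReflectiveNSWithFrobenius F (vecOf F S)
  isReflectiveNS = semigroup , (F∉ , λ x F<x → trans (s≗S x) (S-above-F x F<x)) , reflective
    where
    s = memb (vecOf F S)
    s≗S : ∀ x → s x ≡ S x
    s≗S = memb-vecOf F S S-above-F
    semigroup : IsNumericalSemigroup (λ x → s x ≡ true)
    semigroup = record
      { zero∈    = trans (s≗S 0) S-zero
      ; closed   = λ x y x∈ y∈ → trans (s≗S (x + y))
                     (S-closed x y (trans (sym (s≗S x)) x∈) (trans (sym (s≗S y)) y∈))
      ; cofinite = g + g , λ x 2g≤x → trans (s≗S x) (S-high 2g≤x) }
    F∉ : ¬ s F ≡ true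
    F∉ F∈ = contradiction (trans (sym F∈) (trans (s≗S F) S-F)) λ ()
    reflective : IsReflective (λ x → s x ≡ true)
    reflective = reflective-at s g
      (λ z z<g → trans (s≗S (z + g)) (trans (S-reflect z<g) (cong not (sym (s≗S z)))))
      (λ x 2g≤x → trans (s≗S x) (S-high 2g≤x))

-- Every reflective numerical semigroup is some S⟨ a , g ⟩

module Classification {F : ℕ} (v : Vec Bool (suc F)) (rns : IsReflectiveNSWithFrobenius F v) where
  open IsNumericalSemigroup (proj₁ rns)

  s : ℕ → Bool
  s = memb v

  frobenius : HasFrobenius (λ x → s x ≡ true) F
  frobenius = proj₁ (proj₂ rns)

  reflective : IsReflective (λ x → s x ≡ true)
  reflective = proj₂ (proj₂ rns)

  s-above-F : ∀ x → F < x → s x ≡ true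
  s-above-F = proj₂ frobenius

  sF≡false : s F ≡ false
  sF≡false = ¬-not (proj₁ frobenius)

  g : ℕ
  g = #gaps s (suc F)

  1≤g : 1 ≤ g
  1≤g = subst (1 ≤_) (sym (#gaps-suc-gap s F sF≡false)) (s≤s z≤n)

  reflect : ∀ z → z < g → s (z + g) ≡ not (s z)
  reflect z z<g = reflection-at-genus (reflective g (hasGenus-#gaps s (suc F) s-above-F) 1≤g z z<g)

  sg≡false : s g ≡ false
  sg≡false = trans (reflect 0 1≤g) (cong not zero∈)

  g≤F : g ≤ F
  g≤F = ≮⇒≥ λ F<g → contradiction (trans (sym (s-above-F g F<g)) sg≡false) λ ()

  -- Otherwise the gap F would come on top of the g gaps below 2g.
  F<g+g : F < g + g
  F<g+g = ≰⇒> λ 2g≤F → <-irrefl refl (begin-strict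
    g                ≡⟨ #gaps-double s g reflect ⟨
    #gaps s (g + g)  ≤⟨ #gaps-mono s 2g≤F ⟩
    #gaps s F        <⟨ n<1+n _ ⟩
    suc (#gaps s F)  ≡⟨ #gaps-suc-gap s F sF≡false ⟨
    g                ∎)
    where open ≤-Reasoning

  -- a is the least positive element of S, or g if S has none below g.
  Generator : ℕ → Set
  Generator x = 1 ≤ x × (g ≤ x ⊎ s x ≡ true)

  least-generator : ∃[ a ] Generator a × (∀ {y} → y < a → ¬ Generator y)
  least-generator =
    least-witness (λ x → (1 ≤? x) ×-dec ((g ≤? x) ⊎-dec (s x ≟ᵇ true))) (1≤g , inj₁ ≤-refl)

  a : ℕ
  a = proj₁ least-generator

  generator-a : Generator a
  generator-a = proj₁ (proj₂ least-generator)

  a-least : ∀ {y} → y < a → ¬ Generator y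
  a-least = proj₂ (proj₂ least-generator)

  1≤a : 1 ≤ a
  1≤a = proj₁ generator-a

  a≤g : a ≤ g
  a≤g = ≮⇒≥ λ g<a → a-least g<a (1≤g , inj₁ ≤-refl)

  sa : a < g → s a ≡ true
  sa a<g = [ (λ g≤a → contradiction a<g (≤⇒≯ g≤a)) , id ]′ (proj₂ generator-a)

  below-a : ∀ {y} → y < a → s y ≡ true → y ≡ 0
  below-a {zero}  _   _  = refl
  below-a {suc y} y<a sy = contradiction (s≤s z≤n , inj₂ sy) (a-least y<a)

  s-multiple : ∀ k → k * a < g → s (k * a) ≡ true
  s-multiple zero    _    = zero∈
  s-multiple (suc k) ka<g = closed a (k * a) (sa (≤-<-trans (m≤m+n a (k * a)) ka<g))
                              (s-multiple k (≤-<-trans (m≤n+m (k * a) a) ka<g))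

  -- If x − a were a gap, x − a + g would lie in S and so would x + g = (x − a + g) + a.
  s-a∣ : ∀ x → x < g → s x ≡ true → a ∣ x
  s-a∣ = <-rec _ step
    where
    step : ∀ x → (∀ {y} → y < x → y < g → s y ≡ true → a ∣ y) → x < g → s x ≡ true → a ∣ x
    step x ih x<g sx with a ≤? x
    ... | no  a≰x = subst (a ∣_) (sym (below-a (≰⇒> a≰x) sx)) (a ∣0)
    ... | yes a≤x = ∣m∸n∣n⇒∣m a a≤x (ih x∸a<x (<-trans x∸a<x x<g) s[x∸a]) ∣-refl
      where
      x∸a<x : x ∸ a < x
      x∸a<x = ∸-monoʳ-< 1≤a a≤x
      x∸a+g∈S : s (x ∸ a) ≡ false → s (x ∸ a + g) ≡ true
      x∸a+g∈S s[x∸a]≡false = trans (reflect (x ∸ a) (<-trans x∸a<x x<g)) (cong not s[x∸a]≡false)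
      s[x∸a] : s (x ∸ a) ≡ true
      s[x∸a] = ¬-not λ s[x∸a]≡false → contradiction (begin
        true               ≡⟨ closed (x ∸ a + g) a (x∸a+g∈S s[x∸a]≡false) (sa (≤-<-trans a≤x x<g)) ⟨
        s (x ∸ a + g + a)  ≡⟨ cong s (xy∙z≈xz∙y (x ∸ a) g a) ⟩
        s (x ∸ a + a + g)  ≡⟨ cong (λ w → s (w + g)) (m∸n+n≡m a≤x) ⟩
        s (x + g)          ≡⟨ reflect x x<g ⟩
        not (s x)          ≡⟨ cong not sx ⟩
        false              ∎) λ ()
        where open ≡-Reasoning

  s-low : ∀ x → x < g → s x ≡ does (a ∣? x)
  s-low x x<g with s x in sx
  ... | true  = sym (dec-true (a ∣? x) (s-a∣ x x<g sx))
  ... | false = sym (dec-false (a ∣? x) λ { (divides k refl) →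
                  contradiction (trans (sym (s-multiple k x<g)) sx) λ () })

  t : ℕ
  t = F ∸ g

  t+g≡F : t + g ≡ F
  t+g≡F = m∸n+n≡m g≤F

  t<g : t < g
  t<g = m<n+n⇒m∸n<n g≤F F<g+g

  st : s t ≡ true
  st = begin
    s t              ≡⟨ not-involutive (s t) ⟨
    not (not (s t))  ≡⟨ cong not (reflect t t<g) ⟨
    not (s (t + g))  ≡⟨ cong (not ∘ s) t+g≡F ⟩
    not (s F)        ≡⟨ cong not sF≡false ⟩
    true             ∎
    where open ≡-Reasoning

  admissible : Admissible F a g
  admissible with s-a∣ t t<g st
  ... | divides j t≡ja = record
    { q       = j
    ; F≡g+qa  = trans (sym t+g≡F) (trans (+-comm t g) (cong (g +_) t≡ja))
    ; qa<g    = ja<g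
    ; g≤qa+a  = g≤ja+a
    ; a∣g⇒q≡0 = λ a∣g → n≤0⇒n≡0 (≮⇒≥ λ 0<j →
                  contradiction (trans (sym (s-g a∣g 0<j)) sg≡false) λ ()) }
    where
    ja<g : j * a < g
    ja<g = subst (_< g) t≡ja t<g
    u : ℕ
    u = suc j * a
    F<u+g : F < u + g
    F<u+g = subst (_< u + g) t+g≡F (+-monoˡ-< g (subst (_< u) (sym t≡ja) (m<n+m (j * a) 1≤a)))
    -- Otherwise u = (j + 1) a < g would lie in S, making u + g > F a gap.
    g≤ja+a : g ≤ j * a + a
    g≤ja+a = ≮⇒≥ λ ja+a<g →
      let u<g = subst (_< g) (+-comm (j * a) a) ja+a<g in
      contradiction (trans (sym (s-above-F (u + g) F<u+g)) (trans (reflect u u<g) (cong not (s-multiple (suc j) u<g))))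
                    λ ()
    -- If a ∣ g with j ≥ 1, then g = t + a is a sum of two elements of S.
    s-g : a ∣ g → 0 < j → s g ≡ true
    s-g a∣g 0<j =
      subst (λ w → s w ≡ true) t+a≡g (closed t a st (sa (≤-<-trans (m≤n*m a j {{>-nonZero 0<j}}) ja<g)))
      where
      t+a≡g : t + a ≡ g
      t+a≡g = trans (cong (_+ a) t≡ja) (≤-antisym (multiple-above j a∣g ja<g) g≤ja+a)

  v≡vecOf : v ≡ vecOf F S⟨ a , g ⟩
  v≡vecOf = ≡vecOf v S⟨ a , g ⟩ agree
    where
    open S-Properties a g
    agree : ∀ x → x ≤ F → s x ≡ S⟨ a , g ⟩ x
    agree x x≤F with g ≤? x
    ... | no  g≰x = trans (s-low x (≰⇒> g≰x)) (sym (S-low (≰⇒> g≰x)))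
    ... | yes g≤x = begin
      s x                        ≡⟨ cong s (m∸n+n≡m g≤x) ⟨
      s (x ∸ g + g)              ≡⟨ reflect (x ∸ g) x∸g<g ⟩
      not (s (x ∸ g))            ≡⟨ cong not (s-low (x ∸ g) x∸g<g) ⟩
      not (does (a ∣? (x ∸ g)))  ≡⟨ S-mid g≤x x<2g ⟨
      S⟨ a , g ⟩ x               ∎
      where
      open ≡-Reasoning
      x<2g = ≤-<-trans x≤F F<g+g
      x∸g<g = m<n+n⇒m∸n<n g≤x x<2g

  a≤F : a ≤ F
  a≤F = ≤-trans a≤g g≤F

classify : ∀ {F} (v : Vec Bool (suc F)) → IsReflectiveNSWithFrobenius F v →
  ∃₂ λ a g → Admissible F a g × 1 ≤ a × a ≤ F × v ≡ vecOf F S⟨ a , g ⟩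
classify v rns = a , g , admissible , 1≤a , a≤F , v≡vecOf
  where open Classification v rns

-- Counting the admissible pairs

candidate? : ∀ F k → Dec (¬ suc k ∣ F × (F / suc k) % 2 ≡ 0)
candidate? F k = ¬? (suc k ∣? F) ×-dec ((F / suc k) % 2 ≟ 0)

-- k stands for a = k + 1; the head pred F stands for a = F, i.e. for {0} ∪ (F, ∞).
candidates : ℕ → List ℕ
candidates F = pred F ∷ filter (candidate? F) (upTo F)

genusOf : ℕ → ℕ → ℕ
genusOf F k = F ∸ (F / suc k / 2) * suc k

[qa+r]+qa≡r+q2a : ∀ q a r → (q * a + r) + q * a ≡ r + q * 2 * a
[qa+r]+qa≡r+q2a = solve 3 (λ q a r → (q :* a :+ r) :+ q :* a := r :+ q :* con 2 :* a) refl
  where open +-*-Solver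

admissible-trivial : ∀ F → 1 ≤ F → Admissible F F F
admissible-trivial F 1≤F = record
  { q = 0 ; F≡g+qa = sym (+-identityʳ F) ; qa<g = 1≤F ; g≤qa+a = ≤-refl ; a∣g⇒q≡0 = λ _ → refl }

admissible-proper : ∀ {F a} q r → 1 ≤ r → r < a → F ≡ (q * a + r) + q * a → Admissible F a (q * a + r)
admissible-proper {a = a} q r 1≤r r<a F≡ = record
  { q       = q
  ; F≡g+qa  = F≡
  ; qa<g    = m<m+n (q * a) 1≤r
  ; g≤qa+a  = +-monoʳ-≤ (q * a) (<⇒≤ r<a)
  ; a∣g⇒q≡0 = λ a∣g → contradiction (∣∧<⇒≡0 (∣m+n∣m⇒∣n a∣g (n∣m*n q)) r<a) (>⇒≢ 1≤r) }

candidate⇒admissible : ∀ F′ {k} → k ∈ candidates (suc F′) →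
  Admissible (suc F′) (suc k) (genusOf (suc F′) k) × k < suc F′
candidate⇒admissible F′ (here refl) =
  subst (Admissible F F) (sym genusOf-F′) (admissible-trivial F (s≤s z≤n)) , n<1+n F′
  where
  F = suc F′
  genusOf-F′ : genusOf F F′ ≡ F
  genusOf-F′ = cong (λ w → F ∸ w / 2 * F) (n/n≡1 F)
candidate⇒admissible F′ {k} (there k∈) with ∈-filter⁻ (candidate? (suc F′)) {xs = upTo (suc F′)} k∈
... | k<F , a∤F , F/a-even =
  subst (Admissible F a) (sym genusOf-k) (admissible-proper q r 1≤r (m%n<n F a) F≡[qa+r]+qa) , ∈-upTo⁻ k<F
  where
  F = suc F′
  a = suc k
  q = F / a / 2
  r = F % a
  F≡[qa+r]+qa : F ≡ (q * a + r) + q * a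
  F≡[qa+r]+qa = begin
    F                    ≡⟨ m≡m%n+[m/n]*n F a ⟩
    r + F / a * a        ≡⟨ cong (λ w → r + w * a) (trans (m≡m%n+[m/n]*n (F / a) 2) (cong (_+ q * 2) F/a-even)) ⟩
    r + q * 2 * a        ≡⟨ [qa+r]+qa≡r+q2a q a r ⟨
    (q * a + r) + q * a  ∎
    where open ≡-Reasoning
  genusOf-k : genusOf F k ≡ q * a + r
  genusOf-k = trans (cong (_∸ q * a) F≡[qa+r]+qa) (m+n∸n≡m (q * a + r) (q * a))
  1≤r : 1 ≤ r
  1≤r = n≢0⇒n>0 (a∤F ∘ m%n≡0⇒n∣m F a)

admissible⇒candidate : ∀ F′ {a g} → Admissible (suc F′) a g → 1 ≤ a → a ≤ suc F′ →
  ∃[ k ] suc k ≡ a × k ∈ candidates (suc F′) × genusOf (suc F′) k ≡ g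
admissible⇒candidate F′ {suc k} {g} adm _ a≤F with a<g⊎F≡g≤a
  where open Admissibility adm
... | inj₂ (F≡g , g≤a) = k , refl , subst (_∈ candidates F) (sym k≡F′) (here refl) , genusOf-k
  where
  F = suc F′
  k≡F′ : k ≡ F′
  k≡F′ = suc-injective (≤-antisym a≤F (subst (_≤ suc k) (sym F≡g) g≤a))
  genusOf-k : genusOf F k ≡ g
  genusOf-k = trans (cong (λ w → F ∸ w / 2 * suc k) (trans (cong (λ w → F / suc w) k≡F′) (n/n≡1 F))) F≡g
... | inj₁ a<g = k , refl , there (∈-filter⁺ (candidate? F) (∈-upTo⁺ a≤F) (a∤F , F/a-even)) , genusOf-k
  where
  open Admissible adm
  open Admissibility adm
  F = suc F′
  a = suc k
  r<a = a<g⇒r<a a<g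
  F≡r+q2a : F ≡ r + q * 2 * a
  F≡r+q2a = trans F≡g+qa (trans (cong (_+ q * a) g≡qa+r) ([qa+r]+qa≡r+q2a q a r))
  F/a≡q2 : F / a ≡ q * 2
  F/a≡q2 = trans (cong (_/ a) F≡r+q2a) (r+kd/d≡k (q * 2) r<a)
  a∤F : ¬ a ∣ F
  a∤F a∣F = >⇒≢ 1≤r (begin
    r                    ≡⟨ r+kd%d≡r (q * 2) r<a ⟨
    (r + q * 2 * a) % a  ≡⟨ cong (_% a) F≡r+q2a ⟨
    F % a                ≡⟨ n∣m⇒m%n≡0 F a a∣F ⟩
    0                    ∎)
    where open ≡-Reasoning
  F/a-even : (F / a) % 2 ≡ 0
  F/a-even = trans (cong (_% 2) F/a≡q2) (m*n%n≡0 q 2)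
  genusOf-k : genusOf F k ≡ g
  genusOf-k = begin
    F ∸ F / a / 2 * a  ≡⟨ cong (λ w → F ∸ w / 2 * a) F/a≡q2 ⟩
    F ∸ q * 2 / 2 * a  ≡⟨ cong (λ w → F ∸ w * a) (m*n/n≡m q 2) ⟩
    F ∸ q * a          ≡⟨ cong (_∸ q * a) F≡g+qa ⟩
    g + q * a ∸ q * a  ≡⟨ m+n∸n≡m g (q * a) ⟩
    g                  ∎
    where open ≡-Reasoning

S-distinct : ∀ {F a g a′ g′} → Admissible F a g → Admissible F a′ g′ →
  1 ≤ a → a < a′ → a′ ≤ F →
  vecOf F S⟨ a , g ⟩ ≢ vecOf F S⟨ a′ , g′ ⟩
S-distinct {F} {a} {g} {a′} {g′} adm adm′ 1≤a a<a′ a′≤F v≡v′ = contradiction (begin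
  true                            ≡⟨ dec-true (a ∣? a) ∣-refl ⟨
  does (a ∣? a)                   ≡⟨ S-Properties.S-low a g a<g ⟨
  S⟨ a , g ⟩ a                    ≡⟨ memb-vecOf F S⟨ a , g ⟩ (Soundness.S-above-F adm) a ⟨
  memb (vecOf F S⟨ a , g ⟩) a     ≡⟨ cong (λ w → memb w a) v≡v′ ⟩
  memb (vecOf F S⟨ a′ , g′ ⟩) a   ≡⟨ memb-vecOf F S⟨ a′ , g′ ⟩ (Soundness.S-above-F adm′) a ⟩
  S⟨ a′ , g′ ⟩ a                  ≡⟨ S-Properties.S-low a′ g′ a<g′ ⟩
  does (a′ ∣? a)                  ≡⟨ dec-false (a′ ∣? a) (λ a′∣a → >⇒≢ 1≤a (∣∧<⇒≡0 a′∣a a<a′)) ⟩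
  false                           ∎) λ ()
  where
  open ≡-Reasoning
  a<g : a < g
  a<g = Admissibility.a<F⇒a<g adm (<-≤-trans a<a′ a′≤F)
  a<g′ : a < g′
  a<g′ = <-≤-trans a<a′ (Admissibility.a≤F⇒a≤g adm′ a′≤F)

module Enumeration (F′ : ℕ) where
  F : ℕ
  F = suc F′

  semigroup : ℕ → Vec Bool (suc F)
  semigroup k = vecOf F S⟨ suc k , genusOf F k ⟩

  candidates-unique : Unique (candidates F)
  candidates-unique =
    All.tabulate (λ k∈ F′≡k → proj₁ (proj₂ (∈-filter⁻ (candidate? F) {xs = upTo F} k∈))
                                    (subst (λ w → suc w ∣ F) F′≡k ∣-refl))
    ∷ filter⁺ (candidate? F) (upTo⁺ F)

  semigroup-injective : ∀ {k k′} → k ∈ candidates F → k′ ∈ candidates F →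
    semigroup k ≡ semigroup k′ → k ≡ k′
  semigroup-injective {k} {k′} k∈ k′∈ eq
    with <-cmp k k′ | candidate⇒admissible F′ k∈ | candidate⇒admissible F′ k′∈
  ... | tri< k<k′ _ _ | adm , _   | adm′ , k′<F =
    contradiction eq (S-distinct adm adm′ (s≤s z≤n) (s≤s k<k′) k′<F)
  ... | tri≈ _ k≡k′ _ | _         | _           = k≡k′
  ... | tri> _ _ k′<k | adm , k<F | adm′ , _    =
    contradiction (sym eq) (S-distinct adm′ adm (s≤s z≤n) (s≤s k′<k) k<F)

  ∈⇔isReflectiveNS : ∀ v → v ∈ map semigroup (candidates F) ⇔ IsReflectiveNSWithFrobenius F v
  ∈⇔isReflectiveNS v = mk⇔ sound complete
    where
    sound : v ∈ map semigroup (candidates F) → IsReflectiveNSWithFrobenius F v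
    sound v∈ with ∈-map⁻ semigroup {xs = candidates F} v∈
    ... | k , k∈ , refl = Soundness.isReflectiveNS (proj₁ (candidate⇒admissible F′ k∈))
    complete : IsReflectiveNSWithFrobenius F v → v ∈ map semigroup (candidates F)
    complete rns with classify v rns
    ... | a , g , adm , 1≤a , a≤F , refl with admissible⇒candidate F′ adm 1≤a a≤F
    ...   | k , refl , k∈ , refl = ∈-map⁺ semigroup k∈

corollary5p7 : (F : ℕ) → 1 ≤ F →
    Σ (List (Vec Bool (suc F))) λ L →
      Unique L × (∀ v → v ∈ L ⇔ IsReflectiveNSWithFrobenius F v)
        × length L ≡ 1 + countA F
corollary5p7 (suc F′) _ =
  map semigroup (candidates F) , unique-map⁺ semigroup-injective candidates-unique ,
  ∈⇔isReflectiveNS , length-map semigroup (candidates F)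
  where open Enumeration F′
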